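{- Let $(A,\mathbb{B},\mathbb{B}')$ be a forward exchange matroid. Then $\mathbb{B}'$ is placible.
   Context: An ordered matroid is a pair $(A,\mathbb{B})$ where $A$ is a finite ordered list and $\mathbb{B}$ is a non-empty set of sublists (bases) satisfying basis exchange: for $B,B'\in\mathbb{B}$ and $b\in B\setminus B'$ there is $b'\in B'\setminus B$ with $(B\setminus b)\cup b'\in\mathbb{B}$; all bases have the same cardinality $r$. The rank of $Y\subseteq A$ is the size of a largest subset of $Y$ contained in a basis; $\mathrm{cl}(Y)=\{x\in A:\mathrm{rk}(Y\cup x)=\mathrm{rk}(Y)\}$. For a basis $B$, $x\in A\setminus B$ is externally active if $x\in\mathrm{cl}\{b\in B:b\le x\}$, and $E(B)$ is the set of these. For $B=(b_1,\ldots,b_r)$ ordered as in $A$, $S_i^B=\mathrm{cl}\{b_1,\ldots,b_i\}$ ($S_0^B$ the set of loops, i.e. elements in no basis). A forward exchange matroid is a triple $(A,\mathbb{B},\mathbb{B}')$ with $(A,\mathbb{B})$ an ordered matroid and $\mathbb{B}'\subseteq\mathbb{B}$ such that for all $B\in\mathbb{B}'$, $i\in\{1,\ldots,r\}$, and $x\in S^B_i\setminus(S^B_{i-1}\cup E(B))$, the set $(B\setminus b_i)\cup x$ lies in $\mathbb{B}'$. For $x\in A$: $\mathbb{B}'_{\setminus x}=\{B\in\mathbb{B}':x\notin B\}$ and $\mathbb{B}'_{|x}=\{B\in\mathbb{B}':x\in B\}$. An element $x\in A$ is placeable in a non-empty $\mathbb{B}''\subseteq\mathbb{B}$ if for each $B\in\mathbb{B}''$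 there exists $b\in B$ with $(B\setminus b)\cup x\in\mathbb{B}''$. A non-empty $\mathbb{B}''\subseteq\mathbb{B}$ is placible if either $\mathbb{B}''$ is a singleton, or there exists $x\in A$ that is placeable in $\mathbb{B}''$ such that $\mathbb{B}''_{|x}$ and $\mathbb{B}''_{\setminus x}$ are both non-empty and placible (recursive definition). -}

module Defs where

open import Data.Nat using (ℕ; _≤_)
open import Data.Bool using (Bool; true; false; T; _∧_)
open import Data.Fin using (Fin) renaming (_≤?_ to _≤ᶠ?_; _<?_ to _<ᶠ?_)
open import Data.Fin.Subset using (Subset; _∈_; _∉_; _⊆_; _∪_; _∩_; _-_; ⁅_⁆; ∣_∣; ∁)
open import Data.Fin.Subset.Properties using (_∈?_)
open import Data.Vec using (tabulate)
open import Data.Product using (Σ; ∃; _×_; _,_)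
open import Relation.Nullary using (¬_)
open import Relation.Nullary.Decidable using (⌊_⌋)
open import Relation.Binary.PropositionalEquality using (_≡_)

-- The ground set A is the ordered list of n elements, identified with Fin n
-- carrying its natural order.  Sublists are subsets (Subset n).

Family : ℕ → Set
Family n = Subset n → Bool

swap : ∀ {n} → Subset n → Fin n → Fin n → Subset n
swap B b x = (B - b) ∪ ⁅ x ⁆

record OrderedMatroid (n : ℕ) : Set where
  field
    bases    : Family n
    nonempty : ∃ λ B → T (bases B)
    exchange : ∀ B B' → T (bases B) → T (bases B') →
               ∀ b → b ∈ B → b ∉ B' →
               ∃ λ b' → b' ∈ B' × b' ∉ B × T (bases (swap B b b'))

module _ {n : ℕ} (M : OrderedMatroid n) where
  open OrderedMatroid M

  Indep : Subset n → Set
  Indep I = ∃ λ B → T (bases B) × I ⊆ B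

  IsRank : Subset n → ℕ → Set
  IsRank Y k = (∃ λ I → I ⊆ Y × Indep I × ∣ I ∣ ≡ k)
             × (∀ I → I ⊆ Y → Indep I → ∣ I ∣ ≤ k)

  _∈cl_ : Fin n → Subset n → Set
  x ∈cl Y = ∃ λ k → IsRank Y k × IsRank (Y ∪ ⁅ x ⁆) k

  below≤ : Subset n → Fin n → Subset n
  below≤ B x = B ∩ tabulate (λ c → ⌊ c ≤ᶠ? x ⌋)

  below< : Subset n → Fin n → Subset n
  below< B x = B ∩ tabulate (λ c → ⌊ c <ᶠ? x ⌋)

  ExtActive : Subset n → Fin n → Set
  ExtActive B x = x ∉ B × x ∈cl below≤ B x

  -- Writing B = (b₁,…,b_r) in the order of A,
  -- for b = b_i we have {b₁,…,b_i} = below≤ B b and {b₁,…,b_{i-1}} = below< B b,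
  -- so S_i^B = cl(below≤ B b) and S_{i-1}^B = cl(below< B b)
  -- (for i = 1 this is cl(∅), the set of loops).
  record ForwardExchange (B' : Family n) : Set where
    field
      sub      : ∀ B → T (B' B) → T (bases B)
      forward  : ∀ B → T (B' B) → ∀ b → b ∈ B → ∀ x →
                 x ∈cl below≤ B b → ¬ (x ∈cl below< B b) → ¬ ExtActive B x →
                 T (B' (swap B b x))

module _ {n : ℕ} where

  NonEmpty : Family n → Set
  NonEmpty P = ∃ λ B → T (P B)

  Singleton : Family n → Set
  Singleton P = ∃ λ B → T (P B) × (∀ C → T (P C) → C ≡ B)

  Placeable : Fin n → Family n → Set
  Placeable x P = ∀ B → T (P B) → ∃ λ b → b ∈ B × T (P (swap B b x))

  restrict : Family n → Fin n → Family n
  restrict P x B = P B ∧ ⌊ x ∈? B ⌋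

  delete : Family n → Fin n → Family n
  delete P x B = P B ∧ Data.Bool.not ⌊ x ∈? B ⌋

  data Placible (P : Family n) : Set where
    singleton : Singleton P → Placible P
    split     : (x : Fin n) → NonEmpty P → Placeable x P →
                NonEmpty (restrict P x) → NonEmpty (delete P x) →
                Placible (restrict P x) → Placible (delete P x) → Placible P

-- Process the ground set in order, carrying a family P of bases in which every
-- element of index < k lies in all members of P or in none, and which is still
-- closed under the forward exchanges involving only elements of index ≥ k.
-- Let x be the element of index k.  If x does not split P it is absorbed into
-- the agreeing prefix; otherwise P_{|x} and P_{\x} again satisfy the invariant
-- for k + 1, and x is placeable in P: for B ∈ P with x ∉ B take a member B₀ ∋ x;
-- the first k elements of B lie in B₀, so x is independent of them, while x
-- depends on all of B.  Hence x enters the closure of the prefixes of B exactly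
-- at some b ∈ B of index ≥ k, x is not externally active, and the forward
-- exchange (B ∖ b) ∪ x stays in P.  When k reaches |A| the family is a singleton.
module Submission where

open import Defs
open import Data.Nat using (ℕ; zero; suc; _≤_; _<_; z≤n; s≤s; _+_)
import Data.Nat.Properties as ℕ
open import Data.Bool using (Bool; T)
open import Data.Bool.Properties using (T?; T-∧; T-≡)
open import Data.Fin using (Fin; toℕ; fromℕ<) renaming (_≤?_ to _≤ᶠ?_)
open import Data.Fin.Properties using (toℕ<n; toℕ-fromℕ<; toℕ-injective; <⇒≢; _≟_)
open import Data.Fin.Subset using (Subset; _∈_; _∉_; _⊆_; _∪_; _∩_; _-_; ⁅_⁆; ∣_∣; inside; outside)
open import Data.Fin.Subset.Properties
  using (_∈?_; _⊆?_; _⊂?_; anySubset?; ∪-identityʳ; p⊆q⇒∣p∣≤∣q∣; p⊂q⇒∣p∣<∣q∣; x∈p∪q⁺; x∈p∪q⁻;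
         x∈p∩q⁺; x∈p∩q⁻; p⊆p∪q; p∩q⊆p; p─q⊆p; x∈⁅x⁆; x∈⁅y⁆⇒x≡y; x∈p∧x≢y⇒x∈p-y; ⊆-antisym; ⊆-refl)
open import Data.Vec using (_∷_; tabulate)
open import Data.Vec.Properties using (lookup∘tabulate; []=⇒lookup; lookup⇒[]=)
open import Data.Product using (∃; _×_; _,_; proj₁; proj₂)
open import Data.Sum using (_⊎_; inj₁; inj₂)
open import Function using (_∘_; id; Equivalence)
open import Relation.Nullary using (¬_; yes; no; contradiction)
open import Relation.Nullary.Decidable
  using (⌊_⌋; _×-dec_; toWitness; fromWitness; toWitnessFalse; fromWitnessFalse; decidable-stable)
open import Relation.Unary using (Decidable)
open import Relation.Binary.PropositionalEquality using (_≡_; _≢_; refl; sym; trans; subst)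

open Equivalence using (to; from)

crossing : ∀ {R : ℕ → Set} → Decidable R → ∀ {a N} → a ≤ N → R a → ¬ R N →
           ∃ λ m → a ≤ m × m < N × R m × ¬ R (suc m)
crossing R? {N = zero} z≤n Ra ¬R0 = contradiction Ra ¬R0
crossing R? {N = suc N} a≤1+N Ra ¬R1+N with ℕ.m≤n⇒m<n∨m≡n a≤1+N
... | inj₂ refl = contradiction Ra ¬R1+N
... | inj₁ (s≤s a≤N) with R? N
...   | yes RN = N , a≤N , ℕ.≤-refl , RN , ¬R1+N
...   | no ¬RN = let (m , a≤m , m<N , rest) = crossing R? a≤N Ra ¬RN
                 in m , a≤m , ℕ.m≤n⇒m≤1+n m<N , rest

∣p∪⁅x⁆∣≤1+∣p∣ : ∀ {n} (p : Subset n) x → ∣ p ∪ ⁅ x ⁆ ∣ ≤ suc ∣ p ∣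
∣p∪⁅x⁆∣≤1+∣p∣ (inside ∷ p)  Fin.zero    rewrite ∪-identityʳ p = ℕ.n≤1+n _
∣p∪⁅x⁆∣≤1+∣p∣ (outside ∷ p) Fin.zero    rewrite ∪-identityʳ p = ℕ.≤-refl
∣p∪⁅x⁆∣≤1+∣p∣ (inside ∷ p)  (Fin.suc x) = s≤s (∣p∪⁅x⁆∣≤1+∣p∣ p x)
∣p∪⁅x⁆∣≤1+∣p∣ (outside ∷ p) (Fin.suc x) = ∣p∪⁅x⁆∣≤1+∣p∣ p x

module _ {n : ℕ} where

  ∈-tabulate⁺ : ∀ {f : Fin n → Bool} {c} → T (f c) → c ∈ tabulate f
  ∈-tabulate⁺ {f} {c} fc = lookup⇒[]= c _ (trans (lookup∘tabulate f c) (to T-≡ fc))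

  ∈-tabulate⁻ : ∀ {f : Fin n → Bool} {c} → c ∈ tabulate f → T (f c)
  ∈-tabulate⁻ {f} {c} c∈ = from T-≡ (trans (sym (lookup∘tabulate f c)) ([]=⇒lookup c∈))

  select : {P : Fin n → Set} → Decidable P → Subset n → Subset n
  select P? B = B ∩ tabulate (λ c → ⌊ P? c ⌋)

  ∈-select⁺ : ∀ {P : Fin n → Set} (P? : Decidable P) {B c} → c ∈ B → P c → c ∈ select P? B
  ∈-select⁺ P? c∈B Pc = x∈p∩q⁺ (c∈B , ∈-tabulate⁺ (fromWitness Pc))

  ∈-select⁻ : ∀ {P : Fin n → Set} (P? : Decidable P) {B c} → c ∈ select P? B → c ∈ B × P c
  ∈-select⁻ P? {B} {c} c∈ =
    let (c∈B , c∈tab) = x∈p∩q⁻ B _ c∈ in c∈B , toWitness {a? = P? c} (∈-tabulate⁻ c∈tab)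

  -- prefix B (toℕ b) is definitionally below< B b.
  prefix : Subset n → ℕ → Subset n
  prefix B m = select (λ c → toℕ c ℕ.<? m) B

  ∪⁅⁆⊆ : ∀ {Y Z : Subset n} {x} → Y ⊆ Z → x ∈ Z → Y ∪ ⁅ x ⁆ ⊆ Z
  ∪⁅⁆⊆ {Y} {Z} {x} Y⊆Z x∈Z c∈ with x∈p∪q⁻ Y ⁅ x ⁆ c∈
  ... | inj₁ c∈Y = Y⊆Z c∈Y
  ... | inj₂ c∈⁅x⁆ = subst (_∈ Z) (sym (x∈⁅y⁆⇒x≡y x c∈⁅x⁆)) x∈Z

  ∪⁅⁆-mono : ∀ {Y Z : Subset n} {x} → Y ⊆ Z → Y ∪ ⁅ x ⁆ ⊆ Z ∪ ⁅ x ⁆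
  ∪⁅⁆-mono Y⊆Z = ∪⁅⁆⊆ (λ c∈Y → x∈p∪q⁺ (inj₁ (Y⊆Z c∈Y))) (x∈p∪q⁺ (inj₂ (x∈⁅x⁆ _)))

  swap-self : ∀ {B : Subset n} {x} → x ∈ B → swap B x x ≡ B
  swap-self {B} {x} x∈B = ⊆-antisym (∪⁅⁆⊆ (p─q⊆p B ⁅ x ⁆) x∈B) B⊆swap
    where
    B⊆swap : B ⊆ swap B x x
    B⊆swap {c} c∈B with c ≟ x
    ... | yes refl = x∈p∪q⁺ (inj₂ (x∈⁅x⁆ x))
    ... | no c≢x = x∈p∪q⁺ (inj₁ (x∈p∧x≢y⇒x∈p-y c∈B c≢x))

  ∈-swap : ∀ {B : Subset n} {b x y} → x ∈ B → x ≢ b → x ∈ swap B b y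
  ∈-swap x∈B x≢b = x∈p∪q⁺ (inj₁ (x∈p∧x≢y⇒x∈p-y x∈B x≢b))

  ∉-swap : ∀ {B : Subset n} {b x y} → x ∉ B → x ≢ y → x ∉ swap B b y
  ∉-swap {B} {b} {x} {y} x∉B x≢y x∈ with x∈p∪q⁻ (B - b) ⁅ y ⁆ x∈
  ... | inj₁ x∈B-b = x∉B (p─q⊆p B ⁅ b ⁆ x∈B-b)
  ... | inj₂ x∈⁅y⁆ = x≢y (x∈⁅y⁆⇒x≡y y x∈⁅y⁆)

  Agree : Fin n → Family n → Set
  Agree c P = ∀ {B C} → T (P B) → T (P C) → c ∈ B → c ∈ C

  restrict⁺ : ∀ {P : Family n} {x B} → T (P B) → x ∈ B → T (restrict P x B)
  restrict⁺ PB x∈B = from T-∧ (PB , fromWitness x∈B)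

  restrict⁻ : ∀ {P : Family n} {x B} → T (restrict P x B) → T (P B) × x ∈ B
  restrict⁻ {x = x} {B} r = let (PB , x∈B) = to T-∧ r in PB , toWitness {a? = x ∈? B} x∈B

  delete⁺ : ∀ {P : Family n} {x B} → T (P B) → x ∉ B → T (delete P x B)
  delete⁺ PB x∉B = from T-∧ (PB , fromWitnessFalse x∉B)

  delete⁻ : ∀ {P : Family n} {x B} → T (delete P x B) → T (P B) × x ∉ B
  delete⁻ {x = x} {B} d = let (PB , x∉B) = to T-∧ d in PB , toWitnessFalse {a? = x ∈? B} x∉B

  agree-or-split : ∀ x (P : Family n) → Agree x P ⊎ (NonEmpty (restrict P x) × NonEmpty (delete P x))
  agree-or-split x P with anySubset? (T? ∘ restrict P x) | anySubset? (T? ∘ delete P x)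
  ... | yes r | yes d = inj₂ (r , d)
  ... | no ¬r | _     = inj₁ λ PB _ x∈B → contradiction (_ , restrict⁺ {P = P} PB x∈B) ¬r
  ... | yes _ | no ¬d = inj₁ λ {_} {C} _ PC _ → decidable-stable (x ∈? C) (λ x∉C → ¬d (C , delete⁺ {P = P} PC x∉C))

module _ {n : ℕ} (M : OrderedMatroid n) where
  open OrderedMatroid M

  Indep? : Decidable (Indep M)
  Indep? I = anySubset? (λ B → T? (bases B) ×-dec (I ⊆? B))

  indep-⊆ : ∀ {I J} → J ⊆ I → Indep M I → Indep M J
  indep-⊆ J⊆I (B , B-basis , I⊆B) = B , B-basis , I⊆B ∘ J⊆I

  -- A basis D ⊇ B ∪ x would have to trade x for an element of B outside D.
  basis∪⁅x⁆-dependent : ∀ {B x} → T (bases B) → x ∉ B → ¬ Indep M (B ∪ ⁅ x ⁆)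
  basis∪⁅x⁆-dependent {B} {x} B-basis x∉B (D , D-basis , B∪x⊆D)
    with exchange D B D-basis B-basis x (B∪x⊆D (x∈p∪q⁺ (inj₂ (x∈⁅x⁆ x)))) x∉B
  ... | b , b∈B , b∉D , _ = b∉D (B∪x⊆D (x∈p∪q⁺ (inj₁ b∈B)))

  indep∪⁅x⁆⇒∉cl : ∀ {Y x} → x ∉ Y → Indep M (Y ∪ ⁅ x ⁆) → ¬ _∈cl_ M x Y
  indep∪⁅x⁆⇒∉cl {Y} {x} x∉Y Y∪x-indep (k , ((I , I⊆Y , _ , ∣I∣≡k) , _) , (_ , rank-bound)) =
    ℕ.<⇒≱ (ℕ.<-≤-trans ∣Y∣<∣Y∪x∣ (rank-bound _ ⊆-refl Y∪x-indep))
          (subst (_≤ ∣ Y ∣) ∣I∣≡k (p⊆q⇒∣p∣≤∣q∣ I⊆Y))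
    where
    ∣Y∣<∣Y∪x∣ : ∣ Y ∣ < ∣ Y ∪ ⁅ x ⁆ ∣
    ∣Y∣<∣Y∪x∣ = p⊂q⇒∣p∣<∣q∣ (p⊆p∪q ⁅ x ⁆ , x , x∈p∪q⁺ (inj₂ (x∈⁅x⁆ x)) , x∉Y)

  dependent∪⁅x⁆⇒∈cl : ∀ {Y x} → Indep M Y → ¬ Indep M (Y ∪ ⁅ x ⁆) → _∈cl_ M x Y
  dependent∪⁅x⁆⇒∈cl {Y} {x} Y-indep Y∪x-dep =
    ∣ Y ∣ , ((Y , ⊆-refl , Y-indep , refl) , λ _ I⊆Y _ → p⊆q⇒∣p∣≤∣q∣ I⊆Y)
          , ((Y , p⊆p∪q ⁅ x ⁆ , Y-indep , refl) , bound)
    where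
    bound : ∀ I → I ⊆ Y ∪ ⁅ x ⁆ → Indep M I → ∣ I ∣ ≤ ∣ Y ∣
    bound I I⊆ I-indep with I ⊂? (Y ∪ ⁅ x ⁆)
    ... | yes I⊂ = ℕ.m<1+n⇒m≤n (ℕ.<-≤-trans (p⊂q⇒∣p∣<∣q∣ I⊂) (∣p∪⁅x⁆∣≤1+∣p∣ Y x))
    ... | no ¬I⊂ = contradiction (indep-⊆ Y∪x⊆I I-indep) Y∪x-dep
      where
      Y∪x⊆I : Y ∪ ⁅ x ⁆ ⊆ I
      Y∪x⊆I {c} c∈ = decidable-stable (c ∈? I) λ c∉I → ¬I⊂ (I⊆ , c , c∈ , c∉I)

  prefix-suc⊆below≤ : ∀ {B} b → prefix B (suc (toℕ b)) ⊆ below≤ M B b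
  prefix-suc⊆below≤ b c∈ = let (c∈B , c<1+b) = ∈-select⁻ _ c∈ in ∈-select⁺ (_≤ᶠ? b) c∈B (ℕ.m<1+n⇒m≤n c<1+b)

  below≤⊆prefix : ∀ {B x} → x ∉ B → below≤ M B x ⊆ prefix B (toℕ x)
  below≤⊆prefix {B} {x} x∉B c∈ =
    let (c∈B , c≤x) = ∈-select⁻ (_≤ᶠ? x) c∈
    in ∈-select⁺ _ c∈B (ℕ.≤∧≢⇒< c≤x (λ c≡x → x∉B (subst (_∈ B) (toℕ-injective c≡x) c∈B)))

  closure-jump : ∀ {B x} b → T (bases B) → x ∉ B →
                 Indep M (prefix B (toℕ b) ∪ ⁅ x ⁆) → ¬ Indep M (prefix B (suc (toℕ b)) ∪ ⁅ x ⁆) →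
                 b ∈ B × _∈cl_ M x (below≤ M B b) × ¬ _∈cl_ M x (below< M B b)
  closure-jump {B} {x} b B-basis x∉B before ¬after = b∈B , x∈cl , x∉cl
    where
    b∈B : b ∈ B
    b∈B = decidable-stable (b ∈? B) λ b∉B →
            ¬after (indep-⊆ (∪⁅⁆-mono (below≤⊆prefix b∉B ∘ prefix-suc⊆below≤ b)) before)
    x∈cl : _∈cl_ M x (below≤ M B b)
    x∈cl = dependent∪⁅x⁆⇒∈cl (B , B-basis , p∩q⊆p B _) (¬after ∘ indep-⊆ (∪⁅⁆-mono (prefix-suc⊆below≤ b)))
    x∉cl : ¬ _∈cl_ M x (below< M B b)
    x∉cl = indep∪⁅x⁆⇒∉cl (x∉B ∘ proj₁ ∘ ∈-select⁻ _) before

  forward-position : ∀ {B x} → T (bases B) → x ∉ B → Indep M (prefix B (toℕ x) ∪ ⁅ x ⁆) →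
                     ∃ λ b → b ∈ B × toℕ x ≤ toℕ b × _∈cl_ M x (below≤ M B b) × ¬ _∈cl_ M x (below< M B b)
  forward-position {B} {x} B-basis x∉B start =
    let (m , x≤m , m<n , Rm , ¬R1+m) = crossing (Indep? ∘ R) (ℕ.<⇒≤ (toℕ<n x)) start end-dependent
        b = fromℕ< m<n
        b≡m = toℕ-fromℕ< m<n
        (b∈B , x∈cl , x∉cl) = closure-jump b B-basis x∉B (subst (Indep M ∘ R) (sym b≡m) Rm)
                                                         (subst (¬_ ∘ Indep M ∘ R ∘ suc) (sym b≡m) ¬R1+m)
    in b , b∈B , subst (toℕ x ≤_) (sym b≡m) x≤m , x∈cl , x∉cl
    where
    R : ℕ → Subset n
    R m = prefix B m ∪ ⁅ x ⁆
    end-dependent : ¬ Indep M (R n)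
    end-dependent = basis∪⁅x⁆-dependent B-basis x∉B ∘ indep-⊆ (∪⁅⁆-mono (λ c∈B → ∈-select⁺ _ c∈B (toℕ<n _)))

  not-externally-active : ∀ {B x} → x ∉ B → Indep M (prefix B (toℕ x) ∪ ⁅ x ⁆) → ¬ ExtActive M B x
  not-externally-active x∉B start (_ , x∈cl) =
    indep∪⁅x⁆⇒∉cl (x∉B ∘ proj₁ ∘ ∈-select⁻ _) (indep-⊆ (∪⁅⁆-mono (below≤⊆prefix x∉B)) start) x∈cl

  record Admissible (k : ℕ) (P : Family n) : Set where
    field
      ⊆bases  : ∀ {B} → T (P B) → T (bases B)
      forward : ∀ {B b y} → T (P B) → b ∈ B → k ≤ toℕ b → k ≤ toℕ y →
                _∈cl_ M y (below≤ M B b) → ¬ _∈cl_ M y (below< M B b) → ¬ ExtActive M B y →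
                T (P (swap B b y))
      agree   : ∀ {c} → toℕ c < k → Agree c P

    prefix⊆member : ∀ {B C} → T (P B) → T (P C) → prefix B k ⊆ C
    prefix⊆member PB PC c∈ = let (c∈B , c<k) = ∈-select⁻ _ c∈ in agree c<k PB PC c∈B

  open Admissible

  placeable : ∀ {k P x} → Admissible k P → toℕ x ≡ k → NonEmpty (restrict P x) → Placeable x P
  placeable {P = P} {x} adm refl (B₀ , B₀∈P|x) B B∈P with x ∈? B
  ... | yes x∈B = x , x∈B , subst (T ∘ P) (sym (swap-self x∈B)) B∈P
  ... | no x∉B =
    let (b , b∈B , x≤b , x∈cl , x∉cl) = forward-position (⊆bases adm B∈P) x∉B start
    in b , b∈B , forward adm B∈P b∈B x≤b ℕ.≤-refl x∈cl x∉cl (not-externally-active x∉B start)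
    where
    start : Indep M (prefix B (toℕ x) ∪ ⁅ x ⁆)
    start = let (B₀∈P , x∈B₀) = restrict⁻ {P = P} B₀∈P|x
            in B₀ , ⊆bases adm B₀∈P , ∪⁅⁆⊆ (prefix⊆member adm B∈P B₀∈P) x∈B₀

  admissible-narrow : ∀ {k P Q x} → Admissible k P → toℕ x ≡ k →
    (∀ {B} → T (Q B) → T (P B)) → Agree x Q →
    (∀ {B b y} → T (Q B) → toℕ x < toℕ b → toℕ x < toℕ y → T (P (swap B b y)) → T (Q (swap B b y))) →
    Admissible (suc k) Q
  admissible-narrow {x = x} adm refl Q⊆P agree-x stays = record
    { ⊆bases  = ⊆bases adm ∘ Q⊆P
    ; forward = λ QB b∈B x<b x<y y∈cl y∉cl inactive →
        stays QB x<b x<y (forward adm (Q⊆P QB) b∈B (ℕ.<⇒≤ x<b) (ℕ.<⇒≤ x<y) y∈cl y∉cl inactive)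
    ; agree   = agree′
    }
    where
    agree′ : ∀ {c} → toℕ c < suc (toℕ x) → Agree c _
    agree′ c<1+x with ℕ.m<1+n⇒m<n∨m≡n c<1+x
    ... | inj₁ c<x = λ QB QC → agree adm c<x (Q⊆P QB) (Q⊆P QC)
    ... | inj₂ c≡x rewrite toℕ-injective c≡x = agree-x

  admissible-suc : ∀ {k P x} → Admissible k P → toℕ x ≡ k → Agree x P → Admissible (suc k) P
  admissible-suc adm tx agree-x = admissible-narrow adm tx id agree-x (λ _ _ _ → id)

  admissible-restrict : ∀ {k P x} → Admissible k P → toℕ x ≡ k → Admissible (suc k) (restrict P x)
  admissible-restrict {P = P} adm tx =
    admissible-narrow adm tx (proj₁ ∘ restrict⁻ {P = P}) (λ _ QC _ → proj₂ (restrict⁻ {P = P} QC))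
      λ QB x<b _ P-swap → restrict⁺ {P = P} P-swap (∈-swap (proj₂ (restrict⁻ {P = P} QB)) (<⇒≢ x<b))

  admissible-delete : ∀ {k P x} → Admissible k P → toℕ x ≡ k → Admissible (suc k) (delete P x)
  admissible-delete {P = P} adm tx =
    admissible-narrow adm tx (proj₁ ∘ delete⁻ {P = P}) (λ QB _ x∈B → contradiction x∈B (proj₂ (delete⁻ {P = P} QB)))
      λ QB _ x<y P-swap → delete⁺ {P = P} P-swap (∉-swap (proj₂ (delete⁻ {P = P} QB)) (<⇒≢ x<y))

  admissible⇒placible : ∀ d {k P} → d + k ≡ n → Admissible k P → NonEmpty P → Placible P
  admissible⇒placible zero refl adm (B , PB) =
    singleton (B , PB , λ C PC → ⊆-antisym (agree adm (toℕ<n _) PC PB) (agree adm (toℕ<n _) PB PC))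
  admissible⇒placible (suc d) {k} {P} d+k≡n adm ne = at (fromℕ< k<n) (toℕ-fromℕ< k<n)
    where
    k<n : k < n
    k<n = subst (k <_) d+k≡n (s≤s (ℕ.m≤n+m k d))
    d+1+k≡n : d + suc k ≡ n
    d+1+k≡n = trans (ℕ.+-suc d k) d+k≡n
    at : ∀ x → toℕ x ≡ k → Placible P
    at x tx with agree-or-split x P
    ... | inj₁ agree-x = admissible⇒placible d d+1+k≡n (admissible-suc adm tx agree-x) ne
    ... | inj₂ (P|x , P∖x) =
      split x ne (placeable adm tx P|x) P|x P∖x
            (admissible⇒placible d d+1+k≡n (admissible-restrict adm tx) P|x)
            (admissible⇒placible d d+1+k≡n (admissible-delete adm tx) P∖x)

lemma7p14 : ∀ {n : ℕ} (M : OrderedMatroid n) (B' : Family n) →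
    ForwardExchange M B' → NonEmpty B' → Placible B'
lemma7p14 {n} M B' fe = admissible⇒placible M n (ℕ.+-identityʳ n) initial
  where
  open ForwardExchange fe
  initial : Admissible M 0 B'
  initial = record
    { ⊆bases  = sub _
    ; forward = λ B'B b∈B _ _ → forward _ B'B _ b∈B _
    ; agree   = λ ()
    }
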